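{- Let $n\ge3$, $k\ge2$, $i\in[n-2]$ and $\pi$ a run-sorted permutation of $[n-2]$ with $k-1$ runs. Let $\psi(i,\pi)$ be the word obtained from $\pi$ by increasing by $1$ every entry greater than $i$ and then inserting the two-letter factor $n\,(i+1)$ immediately after the rightmost occurrence (position) of an element of $\{1,\dots,i\}$. Then $\psi(i,\pi)$ is a run-sorted permutation of $[n]$ with $k$ runs in which the removal of the entry $n$ decreases the number of runs.
   Context: A run of a permutation (in one-line notation) is a maximal increasing factor of consecutive letters. A permutation of $[m]$ is run-sorted if it is the concatenation of the blocks of a set partition of $[m]$ in block representation (elements of each block increasing, blocks ordered by increasing minima); equivalently, the minima of its successive runs are increasing. -}

module Defs where

open import Data.Nat using (ℕ; zero; suc; _<_; _<ᵇ_)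
open import Data.Nat.Properties using (_≟_)
open import Data.Bool using (Bool; true; false; if_then_else_; _∧_; not)
open import Data.List using (List; []; _∷_; _++_; map; upTo; filter; length)
open import Data.Bool.ListAction using (any)
open import Data.List.Relation.Unary.Linked using (Linked)
open import Data.List.Relation.Binary.Permutation.Propositional using (_↭_)
open import Relation.Nullary using (¬?)

range : ℕ → List ℕ
range m = map suc (upTo m)

-- a word (list) w is a permutation of [m] (one-line notation)
IsPerm : ℕ → List ℕ → Set
IsPerm m w = w ↭ range m

consFirst : ℕ → List (List ℕ) → List (List ℕ)
consFirst x []       = (x ∷ []) ∷ []
consFirst x (r ∷ rs) = (x ∷ r) ∷ rs

runs : List ℕ → List (List ℕ)
runs []           = []
runs (x ∷ [])     = (x ∷ []) ∷ []
runs (x ∷ y ∷ ys) = if x <ᵇ y then consFirst x (runs (y ∷ ys))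
                    else (x ∷ []) ∷ runs (y ∷ ys)

nRuns : List ℕ → ℕ
nRuns w = length (runs w)

-- minimum of a run = its first letter (runs are increasing and nonempty)
runMin : List ℕ → ℕ
runMin []      = 0
runMin (x ∷ _) = x

RunSorted : List ℕ → Set
RunSorted w = Linked _<_ (map runMin (runs w))

-- insert the word v immediately after the rightmost letter satisfying p
-- (if no letter satisfies p, v is appended at the end; never used here)
insertAfterLast : (ℕ → Bool) → List ℕ → List ℕ → List ℕ
insertAfterLast p v []       = v
insertAfterLast p v (x ∷ xs) =
  if p x ∧ not (any p xs) then x ∷ (v ++ xs) else x ∷ insertAfterLast p v xs

shiftAbove : ℕ → List ℕ → List ℕ
shiftAbove i = map (λ x → if i <ᵇ x then suc x else x)

ψ : ℕ → ℕ → List ℕ → List ℕ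
ψ n i π = insertAfterLast (λ x → x <ᵇ suc i) (n ∷ suc i ∷ []) (shiftAbove i π)

removeEntry : ℕ → List ℕ → List ℕ
removeEntry n = filter (λ x → ¬? (x ≟ n))

-- Shifting the entries above i is strictly increasing, so it preserves the runs of π (hence
-- run-sortedness and the number of runs) and leaves the value i+1 unused. Let x be the rightmost
-- entry ≤ i of the shifted word; every later entry exceeds i+1. Inserting n (i+1) after x appends n
-- to the run of x and starts a new run at i+1 which takes over the rest of that run, while the runs
-- before x are untouched. So exactly one run is added, its minimum i+1 sits between the minimum of
-- the run of x (≤ x ≤ i) and all later minima (> i+1), and deleting n merges i+1 back into the run of x.
module Submission where

open import Defs
open import Data.Bool using (Bool; true; false; T; if_then_else_)
open import Data.Bool.Properties using (∧-zeroʳ)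
open import Data.Bool.ListAction using (any)
open import Data.Nat using (ℕ; suc; _≤_; _<_; _∸_; _+_; _<ᵇ_; _≤′_; ≤′-refl; ≤′-step; s≤s)
open import Data.Nat.Properties
open import Data.List using (List; []; _∷_; _++_; _∷ʳ_; map; drop; length; upTo)
open import Data.List.Properties using (map-++; map-∘; map-cong-local; map-id-local; length-++; length-map; upTo-∷ʳ; filter-accept; filter-reject; filter-all)
open import Data.List.Membership.Propositional using (_∈_)
open import Data.List.Membership.Propositional.Properties using (∈-map⁻; ∈-upTo⁻)
open import Data.List.Relation.Unary.All as All using (All; []; _∷_)
import Data.List.Relation.Unary.All.Properties as Allₚ
open import Data.List.Relation.Unary.Any as Any using (Any; here; there)
import Data.List.Relation.Unary.Any.Properties as Anyₚ
open import Data.List.Relation.Unary.Linked as Linked using (Linked; [-]; _∷_)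
import Data.List.Relation.Unary.Linked.Properties as Linkedₚ
open import Data.List.Relation.Binary.Permutation.Propositional using (_↭_; ↭-refl; ↭-sym; ↭-trans; ↭-prep; ↭-swap; module PermutationReasoning)
open import Data.List.Relation.Binary.Permutation.Propositional.Properties as ↭ using (∷↭∷ʳ; ++⁺ˡ; ++⁺ʳ; All-resp-↭; Any-resp-↭)
open import Data.Empty using (⊥-elim)
open import Data.Product using (_×_; _,_; ∃₂; proj₁; proj₂)
open import Data.Sum using (_⊎_; inj₁; inj₂)
open import Function using (_∘_)
open import Relation.Binary.Definitions using (Monotonic₁)
open import Relation.Binary.PropositionalEquality using (_≡_; _≢_; refl; sym; trans; cong; subst; subst₂; module ≡-Reasoning)
open import Relation.Nullary using (¬_; ¬?; yes; no; contradiction)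
open import Relation.Nullary.Reflects using (ofʸ; ofⁿ)

runs-ascent : ∀ {a b} w → a < b → runs (a ∷ b ∷ w) ≡ consFirst a (runs (b ∷ w))
runs-ascent {a} {b} w a<b with a <ᵇ b | <ᵇ-reflects-< a b
... | true  | _        = refl
... | false | ofⁿ a≮b = contradiction a<b a≮b

runs-descent : ∀ {a b} w → b ≤ a → runs (a ∷ b ∷ w) ≡ (a ∷ []) ∷ runs (b ∷ w)
runs-descent {a} {b} w b≤a with a <ᵇ b | <ᵇ-reflects-< a b
... | false | _       = refl
... | true  | ofʸ a<b = contradiction b≤a (<⇒≱ a<b)

runs-head : ∀ a w → ∃₂ λ r R → runs (a ∷ w) ≡ (a ∷ r) ∷ R
runs-head a [] = [] , [] , refl
runs-head a (b ∷ w) with a <? b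
... | no a≮b rewrite runs-descent w (≮⇒≥ a≮b) = [] , runs (b ∷ w) , refl
... | yes a<b with runs-head b w
...   | r , R , eq rewrite runs-ascent w a<b | eq = b ∷ r , R , refl

runs-All : ∀ {P : List ℕ → Set} → (∀ {a} → P (a ∷ [])) →
           (∀ {a b r} → a < b → P (b ∷ r) → P (a ∷ b ∷ r)) → ∀ w → All P (runs w)
runs-All one grow []          = []
runs-All one grow (a ∷ [])    = one ∷ []
runs-All {P} one grow (a ∷ b ∷ w) = prepend (runs-All one grow (b ∷ w))
  where
  prepend : All P (runs (b ∷ w)) → All P (runs (a ∷ b ∷ w))
  prepend ps with a <? b
  ... | no a≮b rewrite runs-descent w (≮⇒≥ a≮b) = one ∷ ps
  ... | yes a<b rewrite runs-ascent w a<b with runs-head b w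
  ...   | r , R , eq with runs (b ∷ w) | eq | ps
  ...     | _ | refl | p ∷ ps′ = grow a<b p ∷ ps′

firstRun : List (List ℕ) → List ℕ
firstRun []      = []
firstRun (r ∷ _) = r

consFirst-split : ∀ a R → consFirst a R ≡ (a ∷ firstRun R) ∷ drop 1 R
consFirst-split a []      = refl
consFirst-split a (r ∷ R) = refl

runs-∷-below : ∀ {a} w → All (a <_) w → runs (a ∷ w) ≡ consFirst a (runs w)
runs-∷-below []      []          = refl
runs-∷-below (b ∷ w) (a<b ∷ _)   = runs-ascent w a<b

All-runMin-runs : ∀ {P : ℕ → Set} w → All P w → All (P ∘ runMin) (runs w)
All-runMin-runs []          []             = []
All-runMin-runs (a ∷ [])    (pa ∷ [])      = pa ∷ []
All-runMin-runs (a ∷ b ∷ w) (pa ∷ pbw) with a <? b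
... | no a≮b rewrite runs-descent w (≮⇒≥ a≮b) = pa ∷ All-runMin-runs (b ∷ w) pbw
... | yes a<b rewrite runs-ascent w a<b with runs (b ∷ w) | All-runMin-runs (b ∷ w) pbw
...   | []    | []       = pa ∷ []
...   | _ ∷ _ | _ ∷ ps   = pa ∷ ps

map-consFirst : ∀ (f : ℕ → ℕ) a R → consFirst (f a) (map (map f) R) ≡ map (map f) (consFirst a R)
map-consFirst f a []      = refl
map-consFirst f a (r ∷ R) = refl

module _ {f : ℕ → ℕ} (f-mono : Monotonic₁ _<_ _<_ f) where

  mono-≤ : Monotonic₁ _≤_ _≤_ f
  mono-≤ a≤b with m≤n⇒m<n∨m≡n a≤b
  ... | inj₁ a<b  = <⇒≤ (f-mono a<b)
  ... | inj₂ refl = ≤-refl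

  runs-map : ∀ w → runs (map f w) ≡ map (map f) (runs w)
  runs-map []          = refl
  runs-map (a ∷ [])    = refl
  runs-map (a ∷ b ∷ w) = prepend (runs-map (b ∷ w))
    where
    open ≡-Reasoning
    prepend : runs (map f (b ∷ w)) ≡ map (map f) (runs (b ∷ w)) →
              runs (map f (a ∷ b ∷ w)) ≡ map (map f) (runs (a ∷ b ∷ w))
    prepend ih with a <? b
    ... | no a≮b = begin
      runs (f a ∷ f b ∷ map f w)                   ≡⟨ runs-descent (map f w) (mono-≤ (≮⇒≥ a≮b)) ⟩
      (f a ∷ []) ∷ runs (map f (b ∷ w))            ≡⟨ cong ((f a ∷ []) ∷_) ih ⟩
      map (map f) ((a ∷ []) ∷ runs (b ∷ w))        ≡⟨ cong (map (map f)) (runs-descent w (≮⇒≥ a≮b)) ⟨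
      map (map f) (runs (a ∷ b ∷ w))               ∎
    ... | yes a<b = begin
      runs (f a ∷ f b ∷ map f w)                   ≡⟨ runs-ascent (map f w) (f-mono a<b) ⟩
      consFirst (f a) (runs (map f (b ∷ w)))       ≡⟨ cong (consFirst (f a)) ih ⟩
      consFirst (f a) (map (map f) (runs (b ∷ w))) ≡⟨ map-consFirst f a (runs (b ∷ w)) ⟩
      map (map f) (consFirst a (runs (b ∷ w)))     ≡⟨ cong (map (map f)) (runs-ascent w a<b) ⟨
      map (map f) (runs (a ∷ b ∷ w))               ∎

  nRuns-map : ∀ w → nRuns (map f w) ≡ nRuns w
  nRuns-map w = trans (cong length (runs-map w)) (length-map (map f) (runs w))

  RunSorted-map : ∀ w → RunSorted w → RunSorted (map f w)
  RunSorted-map w sorted = subst (Linked _<_) (sym runMins-map) (Linkedₚ.map⁺ (Linked.map f-mono sorted))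
    where
    open ≡-Reasoning
    runMins-map : map runMin (runs (map f w)) ≡ map f (map runMin (runs w))
    runMins-map = begin
      map runMin (runs (map f w))           ≡⟨ cong (map runMin) (runs-map w) ⟩
      map runMin (map (map f) (runs w))     ≡⟨ map-∘ (runs w) ⟨
      map (runMin ∘ map f) (runs w)         ≡⟨ map-cong-local (runs-All refl (λ _ _ → refl) w) ⟩
      map (f ∘ runMin) (runs w)             ≡⟨ map-∘ (runs w) ⟩
      map f (map runMin (runs w))           ∎

-- runs (a ∷ b ∷ w) reduces to consRun a b (runs (b ∷ w)).
consRun : ℕ → ℕ → List (List ℕ) → List (List ℕ)
consRun a b R = if a <ᵇ b then consFirst a R else (a ∷ []) ∷ R

consRun-++ : ∀ a b Ps q → ∃₂ λ Ps′ q′ → ∀ r R → consRun a b (Ps ++ (q ++ r) ∷ R) ≡ Ps′ ++ (q′ ++ r) ∷ R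
consRun-++ a b Ps q with a <ᵇ b
consRun-++ a b Ps       q | false = (a ∷ []) ∷ Ps , q , λ _ _ → refl
consRun-++ a b []       q | true  = [] , a ∷ q , λ _ _ → refl
consRun-++ a b (p ∷ Ps) q | true  = (a ∷ p) ∷ Ps , q , λ _ _ → refl

runs-++-∷ : ∀ A x → ∃₂ λ Ps q → ∀ {w r R} → runs (x ∷ w) ≡ r ∷ R → runs (A ++ x ∷ w) ≡ Ps ++ (q ++ r) ∷ R
runs-++-∷ []           x = [] , [] , λ eq → eq
runs-++-∷ (a ∷ [])     x with consRun-++ a x [] []
... | Ps , q , step = Ps , q , λ eq → trans (cong (consRun a x) eq) (step _ _)
runs-++-∷ (a ∷ b ∷ A)  x with runs-++-∷ (b ∷ A) x
... | Ps₀ , q₀ , prefix with consRun-++ a b Ps₀ q₀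
...   | Ps , q , step = Ps , q , λ eq → trans (cong (consRun a b) (prefix eq)) (step _ _)

runMin-++-∷ : ∀ q x s t → runMin (q ++ x ∷ s) ≡ runMin (q ++ x ∷ t)
runMin-++-∷ []      x s t = refl
runMin-++-∷ (_ ∷ _) x s t = refl

runMin-≤ : ∀ q x s → Linked _<_ (q ++ x ∷ s) → runMin (q ++ x ∷ s) ≤ x
runMin-≤ []           x s _          = ≤-refl
runMin-≤ (c ∷ [])     x s (c<x ∷ _)  = <⇒≤ c<x
runMin-≤ (c ∷ d ∷ q)  x s (c<d ∷ l)  = <⇒≤ (<-≤-trans c<d (runMin-≤ (d ∷ q) x s l))

Linked-insert : ∀ xs {y z} ys → Linked _<_ (xs ++ y ∷ ys) → y < z → All (z <_) ys →
                Linked _<_ (xs ++ y ∷ z ∷ ys)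
Linked-insert []           []       _         y<z []        = y<z ∷ [-]
Linked-insert []           (_ ∷ ys) (_ ∷ l)   y<z (z<c ∷ _) = y<z ∷ z<c ∷ l
Linked-insert (a ∷ [])     ys       (a<y ∷ l) y<z z<ys      = a<y ∷ Linked-insert [] ys l y<z z<ys
Linked-insert (a ∷ b ∷ xs) ys       (a<b ∷ l) y<z z<ys      = a<b ∷ Linked-insert (b ∷ xs) ys l y<z z<ys

length-++-∷ : ∀ {Rs : List (List ℕ)} Ps {r R} → Rs ≡ Ps ++ r ∷ R → length Rs ≡ length Ps + suc (length R)
length-++-∷ Ps eq = trans (cong length eq) (length-++ Ps)

module DescentInsertion (A : List ℕ) {x j N : ℕ} (B : List ℕ)
                        (x<j : x < j) (j<N : j < N) (j<B : All (j <_) B) where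

  private
    C = runs B
    Ps = proj₁ (runs-++-∷ A x)
    q  = proj₁ (proj₂ (runs-++-∷ A x))

    prefix : ∀ {w r R} → runs (x ∷ w) ≡ r ∷ R → runs (A ++ x ∷ w) ≡ Ps ++ (q ++ r) ∷ R
    prefix = proj₂ (proj₂ (runs-++-∷ A x))

    x<B : All (x <_) B
    x<B = All.map (<-trans x<j) j<B

    runs-w : runs (A ++ x ∷ B) ≡ Ps ++ (q ++ x ∷ firstRun C) ∷ drop 1 C
    runs-w = prefix (trans (runs-∷-below B x<B) (consFirst-split x C))

    runs-j : runs (A ++ x ∷ j ∷ B) ≡ Ps ++ (q ++ x ∷ j ∷ firstRun C) ∷ drop 1 C
    runs-j = prefix (trans (runs-ascent B x<j) (cong (consFirst x) (trans (runs-∷-below B j<B) (consFirst-split j C))))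

    runs-Nj : runs (A ++ x ∷ N ∷ j ∷ B) ≡ Ps ++ (q ++ x ∷ N ∷ []) ∷ consFirst j C
    runs-Nj = prefix (trans (runs-ascent (j ∷ B) (<-trans x<j j<N))
                            (cong (consFirst x) (trans (runs-descent B (<⇒≤ j<N))
                                                       (cong ((N ∷ []) ∷_) (runs-∷-below B j<B)))))

  nRuns-insert-j : nRuns (A ++ x ∷ j ∷ B) ≡ nRuns (A ++ x ∷ B)
  nRuns-insert-j = trans (length-++-∷ Ps runs-j) (sym (length-++-∷ Ps runs-w))

  nRuns-insert-Nj : nRuns (A ++ x ∷ N ∷ j ∷ B) ≡ suc (nRuns (A ++ x ∷ B))
  nRuns-insert-Nj = begin
    nRuns (A ++ x ∷ N ∷ j ∷ B)                   ≡⟨ length-++-∷ Ps runs-Nj ⟩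
    length Ps + suc (length (consFirst j C))     ≡⟨ cong (λ R → length Ps + suc (length R)) (consFirst-split j C) ⟩
    length Ps + suc (suc (length (drop 1 C)))    ≡⟨ +-suc (length Ps) _ ⟩
    suc (length Ps + suc (length (drop 1 C)))    ≡⟨ cong suc (length-++-∷ Ps runs-w) ⟨
    suc (nRuns (A ++ x ∷ B))                     ∎
    where open ≡-Reasoning

  RunSorted-insert-Nj : RunSorted (A ++ x ∷ B) → RunSorted (A ++ x ∷ N ∷ j ∷ B)
  RunSorted-insert-Nj sorted = subst (Linked _<_) (sym mins-Nj)
    (Linked-insert (map runMin Ps) (map runMin (drop 1 C)) (subst (Linked _<_) mins-w sorted) μ<j
                   (Allₚ.map⁺ (Allₚ.drop⁺ 1 (All-runMin-runs B j<B))))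
    where
    open ≡-Reasoning
    μ = runMin (q ++ x ∷ N ∷ [])

    mins-w : map runMin (runs (A ++ x ∷ B)) ≡ map runMin Ps ++ μ ∷ map runMin (drop 1 C)
    mins-w = begin
      map runMin (runs (A ++ x ∷ B))                 ≡⟨ cong (map runMin) runs-w ⟩
      map runMin (Ps ++ (q ++ x ∷ firstRun C) ∷ drop 1 C) ≡⟨ map-++ runMin Ps _ ⟩
      map runMin Ps ++ runMin (q ++ x ∷ firstRun C) ∷ map runMin (drop 1 C)
        ≡⟨ cong (λ m → map runMin Ps ++ m ∷ map runMin (drop 1 C)) (runMin-++-∷ q x _ _) ⟩
      map runMin Ps ++ μ ∷ map runMin (drop 1 C)     ∎

    mins-Nj : map runMin (runs (A ++ x ∷ N ∷ j ∷ B)) ≡ map runMin Ps ++ μ ∷ j ∷ map runMin (drop 1 C)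
    mins-Nj = begin
      map runMin (runs (A ++ x ∷ N ∷ j ∷ B))         ≡⟨ cong (map runMin) runs-Nj ⟩
      map runMin (Ps ++ (q ++ x ∷ N ∷ []) ∷ consFirst j C) ≡⟨ map-++ runMin Ps _ ⟩
      map runMin Ps ++ μ ∷ map runMin (consFirst j C)
        ≡⟨ cong (λ R → map runMin Ps ++ μ ∷ map runMin R) (consFirst-split j C) ⟩
      map runMin Ps ++ μ ∷ j ∷ map runMin (drop 1 C) ∎

    μ<j : μ < j
    μ<j = ≤-<-trans (runMin-≤ q x (N ∷ []) increasing) x<j
      where
      increasing : Linked _<_ (q ++ x ∷ N ∷ [])
      increasing = All.head (Allₚ.++⁻ʳ Ps (subst (All (Linked _<_)) runs-Nj
                                                (runs-All [-] _∷_ (A ++ x ∷ N ∷ j ∷ B))))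

module _ (p : ℕ → Bool) (v : List ℕ) where

  insertAfterLast-here : ∀ {y} ys → T (p y) → any p ys ≡ false → insertAfterLast p v (y ∷ ys) ≡ y ∷ v ++ ys
  insertAfterLast-here {y} ys py none rewrite none with p y
  ... | true = refl

  insertAfterLast-later : ∀ y ys → any p ys ≡ true → insertAfterLast p v (y ∷ ys) ≡ y ∷ insertAfterLast p v ys
  insertAfterLast-later y ys some rewrite some | ∧-zeroʳ (p y) = refl

  record LastMatch (w : List ℕ) : Set where
    field
      before   : List ℕ
      letter   : ℕ
      after    : List ℕ
      split    : w ≡ before ++ letter ∷ after
      matches  : T (p letter)
      after-¬p : All (λ y → ¬ T (p y)) after
      inserted : insertAfterLast p v w ≡ before ++ letter ∷ v ++ after

  lastMatch : ∀ w → Any (T ∘ p) w → LastMatch w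
  lastMatch (y ∷ ys) match with any p ys in eq
  lastMatch (y ∷ ys) match        | true  = record
    { LastMatch m ; before = y ∷ before ; split = cong (y ∷_) split
    ; inserted = trans (insertAfterLast-later y ys eq) (cong (y ∷_) inserted) }
    where
    m = lastMatch ys (Anyₚ.any⁻ p ys (subst T (sym eq) _))
    open LastMatch m
  lastMatch (y ∷ ys) (here py)    | false = record
    { before = [] ; letter = y ; after = ys ; split = refl ; matches = py
    ; after-¬p = Allₚ.¬Any⇒All¬ ys (λ later → subst T eq (Anyₚ.any⁺ p later))
    ; inserted = insertAfterLast-here ys py eq }
  lastMatch (y ∷ ys) (there later) | false = ⊥-elim (subst T eq (Anyₚ.any⁺ p later))

-- shiftAbove i is, definitionally, map (bump i).
bump : ℕ → ℕ → ℕ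
bump i x = if i <ᵇ x then suc x else x

bump-cases : ∀ i x → (x ≤ i × bump i x ≡ x) ⊎ (i < x × bump i x ≡ suc x)
bump-cases i x with i <ᵇ x | <ᵇ-reflects-< i x
... | true  | ofʸ i<x = inj₂ (i<x , refl)
... | false | ofⁿ i≮x = inj₁ (≮⇒≥ i≮x , refl)

bump-≤ : ∀ {i x} → x ≤ i → bump i x ≡ x
bump-≤ {i} {x} x≤i with bump-cases i x
... | inj₁ (_ , eq)   = eq
... | inj₂ (i<x , _)  = contradiction x≤i (<⇒≱ i<x)

bump-> : ∀ {i x} → i < x → bump i x ≡ suc x
bump-> {i} {x} i<x with bump-cases i x
... | inj₁ (x≤i , _)  = contradiction x≤i (<⇒≱ i<x)
... | inj₂ (_ , eq)   = eq

bump-mono : ∀ i → Monotonic₁ _<_ _<_ (bump i)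
bump-mono i {x} {y} x<y with bump-cases i x | bump-cases i y
... | inj₁ (_ , ex)   | inj₁ (_ , ey)   rewrite ex | ey = x<y
... | inj₁ (_ , ex)   | inj₂ (_ , ey)   rewrite ex | ey = m<n⇒m<1+n x<y
... | inj₂ (i<x , _)  | inj₁ (y≤i , _)  = contradiction (<-trans i<x x<y) (≤⇒≯ y≤i)
... | inj₂ (_ , ex)   | inj₂ (_ , ey)   rewrite ex | ey = s≤s x<y

bump-≢ : ∀ i x → bump i x ≢ suc i
bump-≢ i x with bump-cases i x
... | inj₁ (x≤i , ex) = λ eq → <-irrefl (trans (sym ex) eq) (s≤s x≤i)
... | inj₂ (i<x , ex) = λ eq → <-irrefl (sym (suc-injective (trans (sym ex) eq))) i<x

range-suc : ∀ m → range (suc m) ≡ range m ∷ʳ suc m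
range-suc m = trans (cong (map suc) (sym (upTo-∷ʳ m))) (map-++ suc (upTo m) (m ∷ []))

range-bounded : ∀ m → All (_≤ m) (range m)
range-bounded m = All.tabulate bounded
  where
  bounded : ∀ {y} → y ∈ range m → y ≤ m
  bounded y∈ with ∈-map⁻ suc y∈
  ... | _ , z∈ , refl = ∈-upTo⁻ z∈

1∈range : ∀ {m} → 1 ≤ m → 1 ∈ range m
1∈range (s≤s _) = here refl

bump-range : ∀ {i m} → i ≤′ m → suc i ∷ map (bump i) (range m) ↭ range (suc m)
bump-range {i} ≤′-refl = begin
  suc i ∷ map (bump i) (range i)  ≡⟨ cong (suc i ∷_) (map-id-local (All.map bump-≤ (range-bounded i))) ⟩
  suc i ∷ range i                 ↭⟨ ∷↭∷ʳ (suc i) (range i) ⟩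
  range i ∷ʳ suc i                ≡⟨ range-suc i ⟨
  range (suc i)                   ∎
  where open PermutationReasoning
bump-range {i} (≤′-step {m} i≤′m) = begin
  suc i ∷ map (bump i) (range (suc m))             ≡⟨ cong (λ xs → suc i ∷ map (bump i) xs) (range-suc m) ⟩
  suc i ∷ map (bump i) (range m ∷ʳ suc m)          ≡⟨ cong (suc i ∷_) (map-++ (bump i) (range m) (suc m ∷ [])) ⟩
  suc i ∷ map (bump i) (range m) ∷ʳ bump i (suc m) ≡⟨ cong (λ y → suc i ∷ map (bump i) (range m) ∷ʳ y) (bump-> (s≤s (≤′⇒≤ i≤′m))) ⟩
  (suc i ∷ map (bump i) (range m)) ∷ʳ suc (suc m)  ↭⟨ ++⁺ʳ (suc (suc m) ∷ []) (bump-range i≤′m) ⟩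
  range (suc m) ∷ʳ suc (suc m)                     ≡⟨ range-suc (suc m) ⟨
  range (suc (suc m))                              ∎
  where open PermutationReasoning

↭-pull : ∀ A (x y : ℕ) w → A ++ x ∷ y ∷ w ↭ y ∷ A ++ x ∷ w
↭-pull A x y w = ↭-trans (++⁺ˡ A (↭-swap x y (↭-refl {x = w}))) (↭.shift y A (x ∷ w))

removeEntry-++-∷ : ∀ {n} A x w → All (_≢ n) (A ++ x ∷ w) → removeEntry n (A ++ x ∷ n ∷ w) ≡ A ++ x ∷ w
removeEntry-++-∷ {n} []      x w (x≢n ∷ w≢n) = begin
  removeEntry n (x ∷ n ∷ w)  ≡⟨ filter-accept (λ y → ¬? (y ≟ n)) x≢n ⟩
  x ∷ removeEntry n (n ∷ w)  ≡⟨ cong (x ∷_) (filter-reject (λ y → ¬? (y ≟ n)) (λ n≢n → n≢n refl)) ⟩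
  x ∷ removeEntry n w        ≡⟨ cong (x ∷_) (filter-all (λ y → ¬? (y ≟ n)) w≢n) ⟩
  x ∷ w                      ∎
  where open ≡-Reasoning
removeEntry-++-∷ {n} (a ∷ A) x w (a≢n ∷ rest) =
  trans (filter-accept (λ y → ¬? (y ≟ n)) a≢n) (cong (a ∷_) (removeEntry-++-∷ A x w rest))

↭-insert-max : ∀ {m} A x w → A ++ x ∷ w ↭ range m → A ++ x ∷ suc m ∷ w ↭ range (suc m)
↭-insert-max {m} A x w perm = begin
  A ++ x ∷ suc m ∷ w   ↭⟨ ↭-pull A x (suc m) w ⟩
  suc m ∷ A ++ x ∷ w   ↭⟨ ↭-prep (suc m) perm ⟩
  suc m ∷ range m      ↭⟨ ∷↭∷ʳ (suc m) (range m) ⟩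
  range m ∷ʳ suc m     ≡⟨ range-suc m ⟨
  range (suc m)        ∎
  where open PermutationReasoning

module Insertion {m i : ℕ} {π : List ℕ} (1≤i : 1 ≤ i) (i≤m : i ≤ m) (π↭ : IsPerm m π) where

  private
    n = suc (suc m)
    j = suc i

    j∷π′↭ : j ∷ shiftAbove i π ↭ range (suc m)
    j∷π′↭ = ↭-trans (↭-prep j (↭.map⁺ (bump i) π↭)) (bump-range (≤⇒≤′ i≤m))

    small-in-π′ : Any (T ∘ (_<ᵇ j)) (shiftAbove i π)
    small-in-π′ = Anyₚ.map⁺ (Any.map one-small (Any-resp-↭ (↭-sym π↭) (1∈range (≤-trans 1≤i i≤m))))
      where
      one-small : ∀ {y} → 1 ≡ y → T (bump i y <ᵇ j)
      one-small refl = subst (λ y → T (y <ᵇ j)) (sym (bump-≤ 1≤i)) (<⇒<ᵇ (s≤s 1≤i))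

    open LastMatch (lastMatch (_<ᵇ j) (n ∷ j ∷ []) (shiftAbove i π) small-in-π′)

    x<j : letter < j
    x<j = <ᵇ⇒< letter j matches

    j<after : All (j <_) after
    j<after = All.zipWith above (after-¬p , All.tail (Allₚ.++⁻ʳ before (subst (All (_≢ j)) split avoids-j)))
      where
      avoids-j : All (_≢ j) (shiftAbove i π)
      avoids-j = Allₚ.map⁺ (All.universal (bump-≢ i) π)
      above : ∀ {y} → ¬ T (y <ᵇ j) × y ≢ j → j < y
      above (y≮j , y≢j) = ≤∧≢⇒< (≮⇒≥ (y≮j ∘ <⇒<ᵇ)) (y≢j ∘ sym)

    open DescentInsertion before after x<j (s≤s (s≤s i≤m)) j<after

    removed↭ : before ++ letter ∷ j ∷ after ↭ range (suc m)
    removed↭ = ↭-trans (↭-pull before letter j after) (subst (λ w → j ∷ w ↭ range (suc m)) split j∷π′↭)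

    removed : removeEntry n (ψ n i π) ≡ before ++ letter ∷ j ∷ after
    removed = trans (cong (removeEntry n) inserted)
                    (removeEntry-++-∷ before letter (j ∷ after)
                       (All.map (λ y≤ → <⇒≢ (s≤s y≤)) (All-resp-↭ (↭-sym removed↭) (range-bounded (suc m)))))

    nRuns-π′ : nRuns (before ++ letter ∷ after) ≡ nRuns π
    nRuns-π′ = trans (cong nRuns (sym split)) (nRuns-map (bump-mono i) π)

  ψ-perm : IsPerm n (ψ n i π)
  ψ-perm = subst (_↭ range n) (sym inserted) (↭-insert-max before letter (j ∷ after) removed↭)

  ψ-sorted : RunSorted π → RunSorted (ψ n i π)
  ψ-sorted sorted = subst RunSorted (sym inserted)
                          (RunSorted-insert-Nj (subst RunSorted split (RunSorted-map (bump-mono i) π sorted)))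

  nRuns-ψ : nRuns (ψ n i π) ≡ suc (nRuns π)
  nRuns-ψ = trans (cong nRuns inserted) (trans nRuns-insert-Nj (cong suc nRuns-π′))

  nRuns-removeEntry-ψ : nRuns (removeEntry n (ψ n i π)) ≡ nRuns π
  nRuns-removeEntry-ψ = trans (cong nRuns removed) (trans nRuns-insert-j nRuns-π′)

lemma22 : (n k i : ℕ) (π : List ℕ) → 3 ≤ n → 2 ≤ k → 1 ≤ i → i ≤ n ∸ 2 →
          IsPerm (n ∸ 2) π → RunSorted π → nRuns π ≡ k ∸ 1 →
          IsPerm n (ψ n i π) × RunSorted (ψ n i π) × nRuns (ψ n i π) ≡ k
            × nRuns (removeEntry n (ψ n i π)) < nRuns (ψ n i π)
lemma22 (suc (suc m)) (suc (suc k)) i π (s≤s (s≤s _)) (s≤s (s≤s _)) 1≤i i≤m π↭ π-sorted π-runs =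
  ψ-perm , ψ-sorted π-sorted , trans nRuns-ψ (cong suc π-runs) ,
  subst₂ _<_ (sym nRuns-removeEntry-ψ) (sym nRuns-ψ) (n<1+n (nRuns π))
  where open Insertion 1≤i i≤m π↭
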